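{- Let $M\subseteq\mathbb{T}$ satisfy the standing hypothesis. The complete shell of $\rho^\forall_M$ for set-union is $\lambda X.\,X\cap M$; i.e., the $\sqsubseteq$-greatest upper closure operator $\eta$ on $\langle\wp(\mathbb{T}),\supseteq\rangle$ with $\eta\sqsubseteq\rho^\forall_M$ and $\eta(X\cup Y)=\eta(\eta(X)\cup\eta(Y))$ for all $X,Y\subseteq\mathbb{T}$ is $\lambda X.\,X\cap M$, whose set of fixpoints is $\{X\subseteq\mathbb{T}\mid X\subseteq M\}$.
   Context: $\mathbb{T}$ is the set of traces $\langle i,\sigma\rangle$, $i\in\mathbb{Z}$, $\sigma:\mathbb{Z}\to\mathbb{S}$; $X_{\downarrow s}=\{\langle i,\sigma\rangle\in X\mid\sigma_i=s\}$; $\oplus(X)=\{\langle i,\sigma\rangle\mid\langle i+1,\sigma\rangle\in X\}$, $\ominus(X)=\{\langle i,\sigma\rangle\mid\langle i-1,\sigma\rangle\in X\}$, $\curvearrowleft(X)=\{\langle -i,\lambda k.\sigma_{ -k}\rangle\mid\langle i,\sigma\rangle\in X\}$. Standing hypothesis on $M$: (i) $|M_{\downarrow s}|>1$ for all $s$; (ii) $\oplus(M)=M=\ominus(M)$ and $\oplus(\curvearrowleft M)=\curvearrowleft M=\ominus(\curvearrowleft M)$. $\rho^\forall_M(X)=\{\langle i,\sigma\rangle\in M\mid M_{\downarrow\sigma_i}\subseteq X\}$. Upper closure operators on $\langle\wp(\mathbb{T}),\supseteq\rangle$: maps monotone w.r.t. $\subseteq$, idempotent, with $\rho(X)\subseteq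 X$; $\rho\sqsubseteq\eta$ iff $\rho(X)\supseteq\eta(X)$ for all $X$. -}

module Defs where

open import Level using (0ℓ)
open import Data.Integer using (ℤ; _+_; -_; 1ℤ; _-_)
open import Data.Product using (_×_; _,_; ∃; ∃-syntax; proj₁; proj₂)
open import Relation.Binary.PropositionalEquality using (_≡_; _≢_)
open import Relation.Unary using (Pred; _⊆_; _≐_; _∩_; _∪_)

-- Traces over a state set 𝕊: a current index i together with σ : ℤ → 𝕊
Trace : Set → Set
Trace 𝕊 = ℤ × (ℤ → 𝕊)

TSet : Set → Set₁
TSet 𝕊 = Pred (Trace 𝕊) 0ℓ

module _ {𝕊 : Set} where

  _↓_ : TSet 𝕊 → 𝕊 → TSet 𝕊
  (X ↓ s) (i , σ) = X (i , σ) × σ i ≡ s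

  ⊕ : TSet 𝕊 → TSet 𝕊
  ⊕ X (i , σ) = X (i + 1ℤ , σ)

  ⊖ : TSet 𝕊 → TSet 𝕊
  ⊖ X (i , σ) = X (i - 1ℤ , σ)

  ↶ : TSet 𝕊 → TSet 𝕊
  ↶ X t = ∃[ u ] (X u × t ≡ (- proj₁ u , λ k → proj₂ u (- k)))

  MoreThanOne : TSet 𝕊 → Set
  MoreThanOne X = ∃[ t ] ∃[ u ] (X t × X u × t ≢ u)

  record Standing (M : TSet 𝕊) : Set₁ where
    field
      nontrivial : ∀ s → MoreThanOne (M ↓ s)
      ⊕-inv      : ⊕ M ≐ M
      ⊖-inv      : ⊖ M ≐ M
      ⊕↶-inv     : ⊕ (↶ M) ≐ ↶ M
      ⊖↶-inv     : ⊖ (↶ M) ≐ ↶ M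

  ρ∀ : TSet 𝕊 → TSet 𝕊 → TSet 𝕊
  ρ∀ M X (i , σ) = M (i , σ) × (M ↓ σ i) ⊆ X

  -- upper closure operator on ⟨℘(𝕋),⊇⟩
  record IsUCO (η : TSet 𝕊 → TSet 𝕊) : Set₁ where
    field
      monotone   : ∀ {X Y} → X ⊆ Y → η X ⊆ η Y
      idempotent : ∀ X → η (η X) ≐ η X
      reductive  : ∀ X → η X ⊆ X

  _⊑_ : (TSet 𝕊 → TSet 𝕊) → (TSet 𝕊 → TSet 𝕊) → Set₁
  ρ ⊑ η = ∀ X → η X ⊆ ρ X

  UnionCondition : (TSet 𝕊 → TSet 𝕊) → Set₁
  UnionCondition η = ∀ X Y → η (X ∪ Y) ≐ η (η X ∪ η Y)

  meetM : TSet 𝕊 → TSet 𝕊 → TSet 𝕊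
  meetM M X = X ∩ M

  IsCompleteShellUnion : (ρ η : TSet 𝕊 → TSet 𝕊) → Set₁
  IsCompleteShellUnion ρ η =
    (IsUCO η × η ⊑ ρ × UnionCondition η)
    × (∀ η′ → IsUCO η′ → η′ ⊑ ρ → UnionCondition η′ → η′ ⊑ η)

{-# OPTIONS --safe #-}
-- If a closure η below ρ∀_M satisfies the union condition, then η(X ∪ Y) ⊆ η X ∪ η Y
-- by reductivity.  For t = ⟨i,σ⟩ ∈ M we have t ∈ ρ∀_M(M↓σᵢ) ⊆ η(M↓σᵢ); splitting M↓σᵢ
-- into {t} and the rest, t cannot lie in η of the rest, so t ∈ η{t} ⊆ η X whenever
-- t ∈ X.  Hence X ∩ M ⊆ η X, and X ↦ X ∩ M is itself such a closure.
module Submission where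

open import Defs
open import Data.Product using (_×_; _,_; proj₁; proj₂)
open import Data.Sum using (inj₁; inj₂)
open import Function.Bundles using (_⇔_; mk⇔)
open import Relation.Unary using (_⊆_; _≐_; _∪_; _∖_; ｛_｝)
open import Level using (0ℓ)
open import Axiom.ExcludedMiddle using (ExcludedMiddle)
open import Relation.Binary.PropositionalEquality using (_≡_; refl)
open import Relation.Nullary using (yes; no; contradiction)

module _ {𝕊 : Set} where

  ∩-isUCO : (M : TSet 𝕊) → IsUCO (meetM M)
  ∩-isUCO M = record
    { monotone   = λ X⊆Y (x , m) → X⊆Y x , m
    ; idempotent = λ X → (λ ((x , _) , m) → x , m) , (λ (x , m) → (x , m) , m)
    ; reductive  = λ X → proj₁
    }

  ∩⊑ρ∀ : (M : TSet 𝕊) → meetM M ⊑ ρ∀ M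
  ∩⊑ρ∀ M X (m , M↓σᵢ⊆X) = M↓σᵢ⊆X (m , refl) , m

  ∩-unionCondition : (M : TSet 𝕊) → UnionCondition (meetM M)
  ∩-unionCondition M X Y =
      (λ { (inj₁ x , m) → inj₁ (x , m) , m ; (inj₂ y , m) → inj₂ (y , m) , m })
    , (λ { (inj₁ (x , _) , m) → inj₁ x , m ; (inj₂ (y , _) , m) → inj₂ y , m })

  ∩-fixed⇔⊆ : (M X : TSet 𝕊) → (meetM M X ≐ X) ⇔ (X ⊆ M)
  ∩-fixed⇔⊆ M X = mk⇔ (λ (_ , X⊆X∩M) {_} x → proj₂ (X⊆X∩M x))
                      (λ X⊆M → (λ {_} → proj₁) , λ {_} x → x , X⊆M x)

  ρ∀-own-class : (M : TSet 𝕊) → ∀ {i σ} → M (i , σ) → ρ∀ M (M ↓ σ i) (i , σ)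
  ρ∀-own-class M m = m , λ a → a

  ⊆-singleton-∪-rest : ExcludedMiddle 0ℓ → ∀ {A : TSet 𝕊} t → A ⊆ ｛ t ｝ ∪ (A ∖ ｛ t ｝)
  ⊆-singleton-∪-rest em t {u} a with em {t ≡ u}
  ... | yes t≡u = inj₁ t≡u
  ... | no  t≢u = inj₂ (a , t≢u)

  module _ {η : TSet 𝕊 → TSet 𝕊} (isUCO : IsUCO η) (union : UnionCondition η) where
    open IsUCO isUCO

    η-∪-split : ∀ X Y → η (X ∪ Y) ⊆ η X ∪ η Y
    η-∪-split X Y t∈ = reductive (η X ∪ η Y) (proj₁ (union X Y) t∈)

    ∈η⇒∈η-singleton : ExcludedMiddle 0ℓ → ∀ {A t} → η A t → η ｛ t ｝ t
    ∈η⇒∈η-singleton em {A} {t} t∈ηA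
      with η-∪-split ｛ t ｝ (A ∖ ｛ t ｝) (monotone (⊆-singleton-∪-rest em {A} t) t∈ηA)
    ... | inj₁ t∈η｛t｝ = t∈η｛t｝
    ... | inj₂ t∈ηrest = contradiction refl (proj₂ (reductive (A ∖ ｛ t ｝) t∈ηrest))

  ∩-greatest : ExcludedMiddle 0ℓ → (M : TSet 𝕊) →
    ∀ η → IsUCO η → η ⊑ ρ∀ M → UnionCondition η → η ⊑ meetM M
  ∩-greatest em M η isUCO η⊑ρ∀ union X {t} (x , m) =
    IsUCO.monotone isUCO (λ { refl → x })
      (∈η⇒∈η-singleton isUCO union em (η⊑ρ∀ (M ↓ _) (ρ∀-own-class M m)))

theorem14 : ExcludedMiddle 0ℓ → {𝕊 : Set} (M : TSet 𝕊) → Standing M →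
    IsCompleteShellUnion (ρ∀ M) (meetM M)
    × (∀ (X : TSet 𝕊) → (meetM M X ≐ X) ⇔ (X ⊆ M))
theorem14 em M _ =
  ((∩-isUCO M , ∩⊑ρ∀ M , ∩-unionCondition M) , ∩-greatest em M) , ∩-fixed⇔⊆ M
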